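{- Let $G$ be a monotonically closing DAG gadget with a state $s$ in which $k$ tunnels are open, and suppose there are no forced distant closings in any state reachable from $s$. Then $G$ has at least $2^k$ states reachable from $s$.
   Context: A gadget consists of finitely many locations and finitely many states; each state $s$ has a set of transitions $(a,b,s')$ meaning a robot may enter at location $a$, exit at location $b$, and the gadget's state becomes $s'$. The gadget is a $k'$-tunnel gadget: its locations are partitioned into pairs called tunnels and every transition goes between the two locations of one tunnel. The state-transition multigraph has a vertex per state and an edge $s\to s'$ for each transition; the gadget is a DAG gadget if this graph is acyclic, and a state is reachable from $s$ if there is a directed path from $s$ to it. A traversal in a state is a direction of a tunnel in which that tunnel can be traversed in that state; a tunnel is open if it has some traversal. An orientation of a set of tunnels in a state consists of one traversal in that state of each tunnel in the set. A distant opening is a transition across some tunnel, from state $s$ to $s'$, such that some other tunnel has a traversal in $s'$ that it does not have in $s$; the gadget is monotonically closing if it has no distant openings. A forced distant closing in a state $s$ is a traversal of some tunnel $t$ in $s$ together with an orientation in $s$ of some set of tunnels other than $t$, such that every transition corresponding to that traversal leads to a state in which at least one traversal of the orientation is no longer possible. -}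

module Defs where

open import Data.Nat using (ℕ; _^_)
open import Data.Fin using (Fin)
open import Data.Bool using (Bool; true; false; not)
open import Data.Maybe using (Maybe; just; nothing)
open import Data.Product using (Σ; ∃; ∃-syntax; _×_; _,_)
open import Relation.Binary.PropositionalEquality using (_≡_; _≢_)
open import Relation.Nullary using (¬_)
open import Function.Definitions using (Injective)
open import Relation.Binary.Construct.Closure.ReflexiveTransitive using (Star)
open import Relation.Binary.Construct.Closure.Transitive using (TransClosure)

-- Locations are
-- Fin nTunnels × Bool: the two locations (t , false) and (t , true)
-- form tunnel t.  A transition (a , b , s') with a = (t , d) and
-- b = (t , not d) is recorded as  δ s t d s' ≡ true  ("d" is the
-- end of tunnel t at which the robot enters).
record Gadget : Set where
  field
    nStates  : ℕ
    nTunnels : ℕ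
    δ        : Fin nStates → Fin nTunnels → Bool → Fin nStates → Bool

  State  = Fin nStates
  Tunnel = Fin nTunnels
  Dir    = Bool

  Transition : State → Tunnel → Dir → State → Set
  Transition s t d s' = δ s t d s' ≡ true

  Step : State → State → Set
  Step s s' = ∃[ t ] ∃[ d ] Transition s t d s'

  Reachable : State → State → Set
  Reachable = Star Step

  IsDAG : Set
  IsDAG = ∀ s → ¬ TransClosure Step s s

  Traversal : State → Tunnel → Dir → Set
  Traversal s t d = ∃[ s' ] Transition s t d s'

  Open : State → Tunnel → Set
  Open s t = ∃[ d ] Traversal s t d

  OpenCount : State → ℕ → Set
  OpenCount s k = Σ (Fin k → Tunnel) λ f →
    Injective _≡_ _≡_ f × (∀ i → Open s (f i)) × (∀ t → Open s t → ∃[ i ] f i ≡ t)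

  DistantOpening : Set
  DistantOpening = ∃[ s ] ∃[ t ] ∃[ d ] ∃[ s' ] Transition s t d s' ×
    (∃[ t' ] ∃[ d' ] t' ≢ t × Traversal s' t' d' × ¬ Traversal s t' d')

  MonotonicallyClosing : Set
  MonotonicallyClosing = ¬ DistantOpening

  -- an orientation in state s of the set of tunnels t with o t ≢ nothing
  IsOrientation : State → (Tunnel → Maybe Dir) → Set
  IsOrientation s o = ∀ t d → o t ≡ just d → Traversal s t d

  ForcedDistantClosing : State → Set
  ForcedDistantClosing s = ∃[ t ] ∃[ d ] Traversal s t d ×
    Σ (Tunnel → Maybe Dir) λ o → IsOrientation s o × o t ≡ nothing ×
      (∀ s' → Transition s t d s' →
        ∃[ t' ] ∃[ d' ] o t' ≡ just d' × ¬ Traversal s' t' d')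

  AtLeastReachable : State → ℕ → Set
  AtLeastReachable s n = Σ (Fin n → State) λ f →
    Injective _≡_ _≡_ f × (∀ i → Reachable s (f i))

{-# OPTIONS --safe #-}
module Submission where

-- Fix a set B of the k open tunnels of s and, once and for all, an
-- orientation of B in s.  While some tunnel outside B is still open, the
-- absence of a forced distant closing yields a transition across it after
-- which every traversal of the orientation is still possible; since the
-- gadget is a DAG this cannot go on forever, so that tunnel eventually
-- closes, and by monotone closing it stays closed while the remaining ones
-- are closed in turn.  The state reached has exactly B open among the k
-- tunnels, so the 2^k choices of B give 2^k distinct reachable states.

open import Defs
open import Data.Nat using (ℕ; zero; suc; _^_)
open import Data.Fin using (Fin; zero; suc; combine; finToFun; funToFin) renaming (_≟_ to _≟ᶠ_)
open import Data.Fin.Properties using (any?; all?; ¬∀⟶∃¬; funToFin-finToFin; 2↔Bool)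
open import Data.Fin.Induction using (spo-noetherian)
open import Data.Bool using (Bool; true; false; if_then_else_) renaming (_≟_ to _≟ᵇ_)
open import Data.Maybe using (Maybe; just; nothing)
open import Data.Sum using (inj₁; inj₂; [_,_]′)
open import Data.Product using (∃-syntax; _×_; _,_; proj₁; proj₂)
open import Data.Empty using (⊥-elim)
open import Function using (_∘_; id; flip)
open import Function.Definitions using (Injective)
open import Function.Bundles using (Inverse; Injection)
open import Function.Properties.Inverse using (Inverse⇒Injection)
open import Induction.WellFounded using (WellFounded; Acc; acc)
open import Relation.Nullary using (¬_; Dec; yes; no; map′; _×-dec_; _⊎-dec_)
open import Relation.Binary.PropositionalEquality
open import Relation.Binary.Construct.Closure.ReflexiveTransitive using (ε; _◅_; _◅◅_)
open import Relation.Binary.Construct.Closure.Transitive using (TransClosure; [_]; _++_)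

funToFin-cong : ∀ {m n} {f g : Fin m → Fin n} → f ≗ g → funToFin f ≡ funToFin g
funToFin-cong {zero}  f≗g = refl
funToFin-cong {suc m} f≗g = cong₂ combine (f≗g zero) (funToFin-cong (f≗g ∘ suc))

finToFun-injective : ∀ {m n} {x y : Fin (m ^ n)} → finToFun x ≗ finToFun y → x ≡ y
finToFun-injective {m} {n} {x} {y} eq = begin
  x                               ≡⟨ funToFin-finToFin {n} {m} x ⟨
  funToFin (finToFun {m} {n} x)   ≡⟨ funToFin-cong {n} {m} eq ⟩
  funToFin (finToFun {m} {n} y)   ≡⟨ funToFin-finToFin {n} {m} y ⟩
  y                               ∎
  where open ≡-Reasoning

bitPattern : ∀ {k} → Fin (2 ^ k) → Fin k → Bool
bitPattern {k} x = Inverse.to 2↔Bool ∘ finToFun {2} {k} x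

bitPattern-injective : ∀ {k} {x y : Fin (2 ^ k)} → bitPattern x ≗ bitPattern y → x ≡ y
bitPattern-injective {k} eq = finToFun-injective {2} {k} (Injection.injective (Inverse⇒Injection 2↔Bool) ∘ eq)

module _ (G : Gadget) where
  open Gadget G

  transition? : ∀ u t d v → Dec (Transition u t d v)
  transition? u t d v = δ u t d v ≟ᵇ true

  traversal? : ∀ u t d → Dec (Traversal u t d)
  traversal? u t d = any? (transition? u t d)

  open? : ∀ u t → Dec (Open u t)
  open? u t = map′ [ (false ,_) , (true ,_) ]′ from (traversal? u t false ⊎-dec traversal? u t true)
    where
      from : Open u t → _
      from (false , tr) = inj₁ tr
      from (true  , tr) = inj₂ tr

  orientedTraversal? : ∀ u (o : Tunnel → Maybe Dir) t → Dec (∀ d → o t ≡ just d → Traversal u t d)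
  orientedTraversal? u o t with o t
  ... | nothing = yes λ _ ()
  ... | just d  = map′ (λ { tr _ refl → tr }) (λ h → h d refl) (traversal? u t d)

  isOrientation? : ∀ u (o : Tunnel → Maybe Dir) → Dec (IsOrientation u o)
  isOrientation? u o = all? (orientedTraversal? u o)

  ¬isOrientation⇒lostTraversal : ∀ {u o} → ¬ IsOrientation u o →
                                  ∃[ t ] ∃[ d ] o t ≡ just d × ¬ Traversal u t d
  ¬isOrientation⇒lostTraversal {u} {o} ¬or with ¬∀⟶∃¬ _ _ (orientedTraversal? u o) ¬or
  ... | t , ¬oriented = t , lost ¬oriented
    where
      lost : ¬ (∀ d → o t ≡ just d → Traversal u t d) → ∃[ d ] o t ≡ just d × ¬ Traversal u t d
      lost ¬oriented with o t
      ... | nothing = ⊥-elim (¬oriented λ _ ())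
      ... | just d  = d , refl , λ tr → ¬oriented λ { _ refl → tr }

  ¬forcedDistantClosing⇒orientationPreservingTransition :
    ∀ {u t d o} → ¬ ForcedDistantClosing u → Traversal u t d → IsOrientation u o → o t ≡ nothing →
    ∃[ v ] Transition u t d v × IsOrientation v o
  ¬forcedDistantClosing⇒orientationPreservingTransition {u} {t} {d} {o} ¬forced trav or ot
    with any? (λ v → transition? u t d v ×-dec isOrientation? v o)
  ... | yes found = found
  ... | no none   = ⊥-elim (¬forced (t , d , trav , o , or , ot ,
                      λ v tr → ¬isOrientation⇒lostTraversal λ or′ → none (v , tr , or′)))

  dag⇒noetherian : IsDAG → WellFounded (flip (TransClosure Step))
  dag⇒noetherian dag = spo-noetherian record
    { isEquivalence = isEquivalence
    ; irrefl        = λ { refl → dag _ }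
    ; trans         = _++_
    ; <-resp-≈      = resp₂ (TransClosure Step)
    }

  module _ (mono : MonotonicallyClosing) where

    step-preserves-closed : ∀ {u v} t → ¬ Open u t → Step u v → ¬ Open v t
    step-preserves-closed {u} {v} t closed (t′ , d′ , tr) (d , trav) with t′ ≟ᶠ t
    ... | yes refl = closed (d′ , v , tr)
    ... | no t′≢t  = mono (u , t′ , d′ , v , tr , t , d , t′≢t ∘ sym , trav , λ trav′ → closed (d , trav′))

    reachable-preserves-closed : ∀ {u v} t → ¬ Open u t → Reachable u v → ¬ Open v t
    reachable-preserves-closed t closed ε          = closed
    reachable-preserves-closed t closed (st ◅ rest) =
      reachable-preserves-closed t (step-preserves-closed t closed st) rest

  NoForcedDistantClosingFrom : State → Set
  NoForcedDistantClosingFrom u = ∀ v → Reachable u v → ¬ ForcedDistantClosing v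

  noForcedDistantClosingFrom-reachable : ∀ {u v} → Reachable u v →
                                         NoForcedDistantClosingFrom u → NoForcedDistantClosingFrom v
  noForcedDistantClosingFrom-reachable u↝v unforced w v↝w = unforced w (u↝v ◅◅ v↝w)

  module _ (dag : IsDAG) where

    close-tunnel : ∀ {u o} t → NoForcedDistantClosingFrom u → IsOrientation u o → o t ≡ nothing →
                   ∃[ v ] Reachable u v × IsOrientation v o × ¬ Open v t
    close-tunnel {u} {o} t unforced or ot = go u (dag⇒noetherian dag u) ε or
      where
        go : ∀ v → Acc (flip (TransClosure Step)) v → Reachable u v → IsOrientation v o →
             ∃[ w ] Reachable u w × IsOrientation w o × ¬ Open w t
        go v (acc rec) u↝v or-v with open? v t
        ... | no closed = v , u↝v , or-v , closed
        ... | yes (d , trav) =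
          let (w , tr , or-w) = ¬forcedDistantClosing⇒orientationPreservingTransition
                                  (unforced v u↝v) trav or-v ot
              step = t , d , tr
          in go w (rec [ step ]) (u↝v ◅◅ step ◅ ε) or-w

    close-if-unoriented : ∀ {u o} t → NoForcedDistantClosingFrom u → IsOrientation u o →
                          ∃[ v ] Reachable u v × IsOrientation v o × (o t ≡ nothing → ¬ Open v t)
    close-if-unoriented {u} {o} t unforced or with o t in ot
    ... | just _  = u , ε , or , λ ()
    ... | nothing with close-tunnel t unforced or ot
    ...   | v , u↝v , or-v , closed = v , u↝v , or-v , λ _ → closed

    module _ (mono : MonotonicallyClosing) where

      close-unoriented : ∀ {u o} n (ts : Fin n → Tunnel) → NoForcedDistantClosingFrom u → IsOrientation u o →
                         ∃[ v ] Reachable u v × IsOrientation v o × (∀ i → o (ts i) ≡ nothing → ¬ Open v (ts i))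
      close-unoriented {u} zero ts unforced or = u , ε , or , λ ()
      close-unoriented (suc n) ts unforced or =
        let (v , u↝v , or-v , closed₀) = close-if-unoriented (ts zero) unforced or
            (w , v↝w , or-w , closed)  = close-unoriented n (ts ∘ suc) (noForcedDistantClosingFrom-reachable u↝v unforced) or-v
        in w , u↝v ◅◅ v↝w , or-w ,
           λ { zero ot → reachable-preserves-closed mono (ts zero) (closed₀ ot) v↝w ; (suc i) → closed i }

      module Keeping {s} (unforced : NoForcedDistantClosingFrom s)
               {k} (f : Fin k → Tunnel) (f-injective : Injective _≡_ _≡_ f)
               (f-open : ∀ i → Open s (f i)) where

        keptOrientation : (Fin k → Bool) → Tunnel → Maybe Dir
        keptOrientation b t with any? (λ j → f j ≟ᶠ t)
        ... | yes (j , _) = if b j then just (proj₁ (f-open j)) else nothing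
        ... | no _        = nothing

        keptOrientation-f : ∀ b j → keptOrientation b (f j) ≡ (if b j then just (proj₁ (f-open j)) else nothing)
        keptOrientation-f b j with any? (λ j′ → f j′ ≟ᶠ f j)
        ... | yes (j′ , fj′≡fj) rewrite f-injective fj′≡fj = refl
        ... | no none = ⊥-elim (none (j , refl))

        keptOrientation-isOrientation : ∀ b → IsOrientation s (keptOrientation b)
        keptOrientation-isOrientation b t d with any? (λ j → f j ≟ᶠ t)
        ... | no _ = λ ()
        ... | yes (j , refl) with b j
        ...   | true  = λ { refl → proj₂ (f-open j) }
        ...   | false = λ ()

        keeping : ∀ b → ∃[ v ] Reachable s v × IsOrientation v (keptOrientation b) ×
                        (∀ t → keptOrientation b t ≡ nothing → ¬ Open v t)
        keeping b = close-unoriented nTunnels id unforced (keptOrientation-isOrientation b)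

        stateKeeping : (Fin k → Bool) → State
        stateKeeping b = proj₁ (keeping b)

        stateKeeping-reachable : ∀ b → Reachable s (stateKeeping b)
        stateKeeping-reachable b = proj₁ (proj₂ (keeping b))

        stateKeeping-open : ∀ b j → b j ≡ true → Open (stateKeeping b) (f j)
        stateKeeping-open b j bj with keeping b
        ... | _ , _ , or , _ = d , or (f j) d (trans (keptOrientation-f b j) (cong (λ x → if x then _ else _) bj))
          where d = proj₁ (f-open j)

        stateKeeping-closed : ∀ b j → b j ≡ false → ¬ Open (stateKeeping b) (f j)
        stateKeeping-closed b j bj with keeping b
        ... | _ , _ , _ , closed = closed (f j) (trans (keptOrientation-f b j) (cong (λ x → if x then _ else _) bj))

        stateKeeping-injective : ∀ {b b′} → stateKeeping b ≡ stateKeeping b′ → b ≗ b′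
        stateKeeping-injective {b} {b′} eq j with b j in bj | b′ j in b′j
        ... | true  | true  = refl
        ... | false | false = refl
        ... | true  | false = ⊥-elim (stateKeeping-closed b′ j b′j (subst (λ v → Open v (f j)) eq (stateKeeping-open b j bj)))
        ... | false | true  = ⊥-elim (stateKeeping-closed b j bj (subst (λ v → Open v (f j)) (sym eq) (stateKeeping-open b′ j b′j)))

open Gadget

lemma5p7 : (G : Gadget) → IsDAG G → MonotonicallyClosing G →
    (s : State G) (k : ℕ) → OpenCount G s k →
    (∀ s' → Reachable G s s' → ¬ ForcedDistantClosing G s') →
    AtLeastReachable G s (2 ^ k)
lemma5p7 G dag mono s k (f , f-injective , f-open , _) unforced =
    stateKeeping ∘ bitPattern
  , bitPattern-injective ∘ stateKeeping-injective
  , stateKeeping-reachable ∘ bitPattern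
  where open Keeping G dag mono unforced f f-injective f-open
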